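{- Let $(\mathcal{M},w)$ and $(\mathcal{N},u)$ be pointed $\Theta$-models, and let $Z$ be a simulation from $(\mathcal{M}^{un}_w,(w))$ to $(\mathcal{N},u)$ whose left projection is all of $W^{un}_w$. Then there is a homomorphism $h:\mathcal{M}^{un}_w\to\mathcal{N}$ such that $h((w))=u$ and $v\mathrel{Z}h(v)$ for every $v\in W^{un}_w$.
   Context: A $\Theta$-model $\mathcal{M}=\langle W,R,V\rangle$: $W$ nonempty, $R$ a preorder, $V:\Theta\to 2^W$ upward closed along $R$; $\mathcal{N}=\langle U,S,Y\rangle$. The intuitionistic unravelling $\mathcal{M}^{un}_w$: worlds are finite sequences $(u_1,\dots,u_n)$, $n\ge1$, with $u_1=w$ and $u_iRu_{i+1}$; the relation is the reflexive transitive closure of one-step extension of sequences; a sequence satisfies $p$ iff its last element is in $V(p)$. A simulation from $(\mathcal{M}_1,w_1)$ to $(\mathcal{M}_2,w_2)$ is $Z\subseteq W_1\times W_2$ with $w_1Zw_2$, such that $vZs$ and $v\in V_1(p)$ imply $s\in V_2(p)$, and $vZs$ and $vR_1u$ imply there is $t\in W_2$ with $sR_2t$ and $uZt$. A homomorphism $h:\mathcal{M}_1\to\mathcal{M}_2$ is a function $W_1\to W_2$ with $v\in V_1(p)\Rightarrow h(v)\in V_2(p)$ and $vR_1u\Rightarrow h(v)R_2h(u)$. -}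

module Defs where

open import Data.Product using (Σ; _×_; _,_; ∃)
open import Relation.Binary.PropositionalEquality using (_≡_)
open import Relation.Binary.Construct.Closure.ReflexiveTransitive
  using (Star; ε; _◅_; _◅◅_)

record Model (Θ : Set) : Set₁ where
  field
    W        : Set
    R        : W → W → Set
    V        : Θ → W → Set
    inhabitant : W
    R-refl   : ∀ {x} → R x x
    R-trans  : ∀ {x y z} → R x y → R y z → R x z
    V-up     : ∀ p {x y} → R x y → V p x → V p y

open Model public

module Unravel {Θ : Set} (M : Model Θ) (w : W M) where

  -- Finite sequences (u₁,…,uₙ), n ≥ 1, u₁ = w, uᵢ R uᵢ₊₁,
  -- built from (w) by appending elements one at a time.
  data Seq : Set
  last : Seq → W M

  data Seq where
    root : Seq
    snoc : (s : Seq) (y : W M) → R M (last s) y → Seq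

  last root         = w
  last (snoc _ y _) = y

  data Step : Seq → Seq → Set where
    step : ∀ s y (r : R M (last s) y) → Step s (snoc s y r)

  Rᵘⁿ : Seq → Seq → Set
  Rᵘⁿ = Star Step

  Vᵘⁿ : Θ → Seq → Set
  Vᵘⁿ p s = V M p (last s)

  last-mono : ∀ {s t} → Rᵘⁿ s t → R M (last s) (last t)
  last-mono ε                  = R-refl M
  last-mono (step s y r ◅ st) = R-trans M r (last-mono st)

  model : Model Θ
  model = record
    { W = Seq ; R = Rᵘⁿ ; V = Vᵘⁿ ; inhabitant = root
    ; R-refl = ε ; R-trans = _◅◅_
    ; V-up = λ p st v → V-up M p (last-mono st) v }

unravel : {Θ : Set} → (M : Model Θ) → W M → Model Θ
unravel M w = Unravel.model M w

root : {Θ : Set} → (M : Model Θ) → (w : W M) → W (unravel M w)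
root M w = Unravel.root

record IsSimulation {Θ : Set} (M₁ M₂ : Model Θ) (w₁ : W M₁) (w₂ : W M₂)
                    (Z : W M₁ → W M₂ → Set) : Set where
  field
    base  : Z w₁ w₂
    atoms : ∀ p {v s} → Z v s → V M₁ p v → V M₂ p s
    forth : ∀ {v s u} → Z v s → R M₁ v u → Σ (W M₂) (λ t → R M₂ s t × Z u t)

record Homomorphism {Θ : Set} (M₁ M₂ : Model Θ) : Set where
  field
    fun    : W M₁ → W M₂
    pres-V : ∀ p {v} → V M₁ p v → V M₂ p (fun v)
    pres-R : ∀ {v u} → R M₁ v u → R M₂ (fun v) (fun u)

open Homomorphism public

-- The unravelling is a tree: every sequence arises from the root (w) by a
-- unique chain of one-step extensions.  So h can be defined by recursion on
-- sequences, sending (w) to u and an extension s ↦ (s, y) to the successor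
-- that the forth condition provides for h s along that step; each choice is
-- made exactly once, hence h is a function, Z-related to its argument, and
-- monotone on steps, and therefore on their reflexive transitive closure.
module Submission where

open import Defs
open import Data.Product using (Σ; _×_; _,_; ∃; proj₁; proj₂)
open import Relation.Binary.PropositionalEquality using (_≡_; refl)
open import Relation.Binary.Construct.Closure.ReflexiveTransitive using (ε; _◅_)

module SimulationToHomomorphism {Θ : Set} (M N : Model Θ) (w : W M) (u : W N)
    (Z : W (unravel M w) → W N → Set)
    (sim : IsSimulation (unravel M w) N (root M w) u Z) where
  open Unravel M w
  open IsSimulation sim

  forth-step : ∀ {s t} (x : Z s t) {s′} → Step s s′ → Σ (W N) (λ t′ → R N t t′ × Z s′ t′)
  forth-step x st = forth x (st ◅ ε)

  witness : (s : Seq) → ∃ (Z s)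
  witness root         = u , base
  witness (snoc s y r) with forth-step (proj₂ (witness s)) (step s y r)
  ... | t , _ , z = t , z

  h : Seq → W N
  h s = proj₁ (witness s)

  h-Z : ∀ s → Z s (h s)
  h-Z s = proj₂ (witness s)

  h-step : ∀ {s t} → Step s t → R N (h s) (h t)
  h-step (step s y r) = proj₁ (proj₂ (forth-step (h-Z s) (step s y r)))

  h-mono : ∀ {s t} → Rᵘⁿ s t → R N (h s) (h t)
  h-mono ε          = R-refl N
  h-mono (st ◅ sts) = R-trans N (h-step st) (h-mono sts)

  homomorphism : Homomorphism (unravel M w) N
  homomorphism = record
    { fun    = h
    ; pres-V = λ p {s} → atoms p (h-Z s)
    ; pres-R = h-mono
    }

lemma3p2 : {Θ : Set} (M N : Model Θ) (w : W M) (u : W N)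
    (Z : W (unravel M w) → W N → Set) →
    IsSimulation (unravel M w) N (root M w) u Z →
    (∀ v → ∃ (λ s → Z v s)) →
    Σ (Homomorphism (unravel M w) N)
    (λ h → (fun h (root M w) ≡ u) × (∀ v → Z v (fun h v)))
lemma3p2 M N w u Z sim _ = homomorphism , refl , h-Z
  where open SimulationToHomomorphism M N w u Z sim
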